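{- There is no disjunction-free formula $A\in\mathsf{Form}_{\bot,\supset}$ such that (i) $\mathbf{S}_\bot2\vdash A$ and (ii) the system $\mathbf{S}^-_\bot2+A$ (obtained by adding $A$ as an extra axiom) derives $(p\supset r)\to((q\supset r)\to((p\lor q)\supset r))$.
   Context: $\mathsf{Form}_{\bot,\supset}$: formulas built from a countable set $\mathsf{Prop}$ of propositional variables (including distinct $p,q,r$) and the constant $\bot$ using binary connectives $\land,\lor,\to,\supset$; disjunction-free means $\lor$ does not occur. $\mathbf{S}_\bot2$ has the following single axioms (with fixed distinct propositional variables $p,q,r$): (Ax0) $\bot\to p$; (Ax1) $p\to(q\to p)$; (Ax2) $(p\to(q\to r))\to((p\to q)\to(p\to r))$; (Ax3) $(p\land q)\to p$; (Ax4) $(p\land q)\to q$; (Ax5) $(r\to p)\to((r\to q)\to(r\to(p\land q)))$; (Ax6) $p\to(p\lor q)$; (Ax7) $q\to(p\lor q)$; (Ax8) $(p\to r)\to((q\to r)\to((p\lor q)\to r))$; (AxM1) $(p\to q)\supset(p\supset q)$; (AxM2) $(p\supset(q\supset r))\to((p\supset q)\supset(p\supset r))$; (AxM3) $(p\supset(q\to r))\to(q\to(p\supset r))$; (AxM4) $(p\to(q\supset r))\to(q\supset(p\to r))$; (AxM5) $((p\supset q)\supset r)\to((p\supset r)\to r)$; (AxM6') $(p\supset r)\to((q\supset r)\to((p\lor q)\supset r))$; and rules: (MP) from $A$ and $A\supset B$ infer $B$; (Sub) from $A$ infer $A[p/B]$ (uniform substitution of $B$ for all occurrences of a propositional variable $p$).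 $\mathbf{S}^-_\bot2$ is the same system without the axiom (AxM6'). $\vdash A$ means $A$ is derivable from no assumptions. -}

module Defs where

open import Data.Nat using (ℕ; _≟_)
open import Data.Bool using (Bool; true; false)
open import Relation.Nullary using (yes; no)
open import Data.Empty using (⊥)
open import Data.Unit using (⊤)
open import Data.Product using (_×_)

Var : Set
Var = ℕ

infixr 20 _∧′_
infixr 19 _∨′_
infixr 18 _⇒_
infixr 17 _⊃_

data Form : Set where
  var  : Var → Form
  bot  : Form
  _∧′_ : Form → Form → Form
  _∨′_ : Form → Form → Form
  _⇒_  : Form → Form → Form   -- the connective →
  _⊃_  : Form → Form → Form

p q r : Form
p = var 0
q = var 1
r = var 2

DisjFree : Form → Set
DisjFree (var _)  = ⊤
DisjFree bot      = ⊤
DisjFree (A ∧′ B) = DisjFree A × DisjFree B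
DisjFree (A ∨′ B) = ⊥
DisjFree (A ⇒ B)  = DisjFree A × DisjFree B
DisjFree (A ⊃ B)  = DisjFree A × DisjFree B

_[_≔_] : Form → Var → Form → Form
var y    [ x ≔ B ] with y ≟ x
... | yes _ = B
... | no _  = var y
bot      [ x ≔ B ] = bot
(C ∧′ D) [ x ≔ B ] = (C [ x ≔ B ]) ∧′ (D [ x ≔ B ])
(C ∨′ D) [ x ≔ B ] = (C [ x ≔ B ]) ∨′ (D [ x ≔ B ])
(C ⇒ D)  [ x ≔ B ] = (C [ x ≔ B ]) ⇒ (D [ x ≔ B ])
(C ⊃ D)  [ x ≔ B ] = (C [ x ≔ B ]) ⊃ (D [ x ≔ B ])

AxM6′ : Form
AxM6′ = (p ⊃ r) ⇒ ((q ⊃ r) ⇒ ((p ∨′ q) ⊃ r))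

-- The axioms of S⁻_⊥2 (all except AxM6')
data BaseAxiom : Form → Set where
  ax0  : BaseAxiom (bot ⇒ p)
  ax1  : BaseAxiom (p ⇒ (q ⇒ p))
  ax2  : BaseAxiom ((p ⇒ (q ⇒ r)) ⇒ ((p ⇒ q) ⇒ (p ⇒ r)))
  ax3  : BaseAxiom ((p ∧′ q) ⇒ p)
  ax4  : BaseAxiom ((p ∧′ q) ⇒ q)
  ax5  : BaseAxiom ((r ⇒ p) ⇒ ((r ⇒ q) ⇒ (r ⇒ (p ∧′ q))))
  ax6  : BaseAxiom (p ⇒ (p ∨′ q))
  ax7  : BaseAxiom (q ⇒ (p ∨′ q))
  ax8  : BaseAxiom ((p ⇒ r) ⇒ ((q ⇒ r) ⇒ ((p ∨′ q) ⇒ r)))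
  axM1 : BaseAxiom ((p ⇒ q) ⊃ (p ⊃ q))
  axM2 : BaseAxiom ((p ⊃ (q ⊃ r)) ⇒ ((p ⊃ q) ⊃ (p ⊃ r)))
  axM3 : BaseAxiom ((p ⊃ (q ⇒ r)) ⇒ (q ⇒ (p ⊃ r)))
  axM4 : BaseAxiom ((p ⇒ (q ⊃ r)) ⇒ (q ⊃ (p ⇒ r)))
  axM5 : BaseAxiom (((p ⊃ q) ⊃ r) ⇒ ((p ⊃ r) ⇒ r))

data S2Axiom : Form → Set where
  base : ∀ {A} → BaseAxiom A → S2Axiom A
  axM6 : S2Axiom AxM6′

data Derivable (Ax : Form → Set) : Form → Set where
  axiom : ∀ {A} → Ax A → Derivable Ax A
  mp    : ∀ {A B} → Derivable Ax A → Derivable Ax (A ⊃ B) → Derivable Ax B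
  sub   : ∀ {A} (x : Var) (B : Form) → Derivable Ax A → Derivable Ax (A [ x ≔ B ])

S2⊢_ : Form → Set
S2⊢ A = Derivable S2Axiom A

data MinusPlus (E : Form) : Form → Set where
  base  : ∀ {A} → BaseAxiom A → MinusPlus E A
  extra : MinusPlus E E

_⊢⁻+_ : Form → Form → Set
E ⊢⁻+ A = Derivable (MinusPlus E) A

-- Interpret → by Heyting implication and ⊃ by the strict implication (x ⊃ y is y
-- if x is the top element and ⊤ otherwise); then MP and Sub preserve validity.
-- In the five-element Heyting algebra 𝟚²⁺, obtained from the four-element Boolean
-- algebra 𝟚² by adjoining a new top above a ∨ b, all axioms of S_⊥2 are valid.
-- The map 𝟚² → 𝟚²⁺ sending the old top to the new one preserves ⊥, ∧, → and ⊃
-- (but not ∨) and reflects the top, so a disjunction-free theorem of S_⊥2 is also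
-- valid in 𝟚². There all axioms of S⁻_⊥2 hold, but AxM6′ fails at p = a, q = b,
-- r = ⊥: a ∨ b is now the top, so (a ∨ b) ⊃ ⊥ = ⊥ while a ⊃ ⊥ = b ⊃ ⊥ = ⊤.
module Submission where

open import Defs
open import Data.Bool using (Bool; true; false; not; if_then_else_)
import Data.Bool as Bool
open import Data.Maybe using (Maybe; nothing; just)
import Data.Maybe.Properties as Maybe
open import Data.Nat using (suc; _≟_)
open import Data.Product using (Σ; _×_; _,_; zip′)
import Data.Product.Properties as Product
open import Data.Empty using (⊥)
open import Data.Unit using (⊤)
open import Relation.Nullary using (¬_; Dec; yes; no; does)
open import Relation.Nullary.Decidable
  using (True; toWitness; from-yes; map′; dec-true; _×-dec_; _→-dec_)
open import Relation.Unary using (Decidable)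
open import Relation.Binary.PropositionalEquality
  using (_≡_; refl; sym; trans; cong; cong₂; module ≡-Reasoning)

Searchable : Set → Set₁
Searchable A = ∀ {P : A → Set} → Decidable P → Dec (∀ x → P x)

Bool-searchable : Searchable Bool
Bool-searchable P? =
  map′ (λ { (t , f) true → t ; (t , f) false → f }) (λ h → h true , h false)
       (P? true ×-dec P? false)

×-searchable : ∀ {A B} → Searchable A → Searchable B → Searchable (A × B)
×-searchable ∀A? ∀B? P? =
  map′ (λ h (x , y) → h x y) (λ h x y → h (x , y))
       (∀A? λ x → ∀B? λ y → P? (x , y))

Maybe-searchable : ∀ {A} → Searchable A → Searchable (Maybe A)
Maybe-searchable ∀A? P? =
  map′ (λ { (n , j) nothing → n ; (n , j) (just x) → j x })
       (λ h → h nothing , λ x → h (just x))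
       (P? nothing ×-dec ∀A? λ x → P? (just x))

record Model : Set₁ where
  infixr 20 _∧ₐ_
  infixr 19 _∨ₐ_
  infixr 18 _→ₐ_
  infixr 17 _⊃ₐ_
  field
    Carrier         : Set
    ⊥ₐ ⊤ₐ           : Carrier
    _∧ₐ_ _∨ₐ_ _→ₐ_  : Carrier → Carrier → Carrier
    is⊤?            : (x : Carrier) → Dec (x ≡ ⊤ₐ)

  _⊃ₐ_ : Carrier → Carrier → Carrier
  x ⊃ₐ y = if does (is⊤? x) then y else ⊤ₐ

  ⊤ₐ-⊃ₐ : ∀ y → ⊤ₐ ⊃ₐ y ≡ y
  ⊤ₐ-⊃ₐ y rewrite dec-true (is⊤? ⊤ₐ) refl = refl

module Semantics (M : Model) where
  open Model M

  Valuation : Set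
  Valuation = Var → Carrier

  eval : Valuation → Form → Carrier
  eval v (var x)  = v x
  eval v bot      = ⊥ₐ
  eval v (A ∧′ B) = eval v A ∧ₐ eval v B
  eval v (A ∨′ B) = eval v A ∨ₐ eval v B
  eval v (A ⇒ B)  = eval v A →ₐ eval v B
  eval v (A ⊃ B)  = eval v A ⊃ₐ eval v B

  Valid : Form → Set
  Valid A = ∀ v → eval v A ≡ ⊤ₐ

  update : Valuation → Var → Carrier → Valuation
  update v x d y with y ≟ x
  ... | yes _ = d
  ... | no _  = v y

  eval-[≔] : ∀ v x B A → eval v (A [ x ≔ B ]) ≡ eval (update v x (eval v B)) A
  eval-[≔] v x B (var y) with y ≟ x
  ... | yes _ = refl
  ... | no _  = refl
  eval-[≔] v x B bot      = refl
  eval-[≔] v x B (C ∧′ D) = cong₂ _∧ₐ_ (eval-[≔] v x B C) (eval-[≔] v x B D)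
  eval-[≔] v x B (C ∨′ D) = cong₂ _∨ₐ_ (eval-[≔] v x B C) (eval-[≔] v x B D)
  eval-[≔] v x B (C ⇒ D)  = cong₂ _→ₐ_ (eval-[≔] v x B C) (eval-[≔] v x B D)
  eval-[≔] v x B (C ⊃ D)  = cong₂ _⊃ₐ_ (eval-[≔] v x B C) (eval-[≔] v x B D)

  sound : ∀ {Ax} → (∀ {A} → Ax A → Valid A) → ∀ {A} → Derivable Ax A → Valid A
  sound axioms-valid (axiom a) = axioms-valid a
  sound axioms-valid (mp {A} {B} ⊢A ⊢A⊃B) v = begin
    eval v B               ≡⟨ sym (⊤ₐ-⊃ₐ (eval v B)) ⟩
    ⊤ₐ ⊃ₐ eval v B         ≡⟨ cong (_⊃ₐ eval v B) (sym (sound axioms-valid ⊢A v)) ⟩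
    eval v A ⊃ₐ eval v B   ≡⟨ sound axioms-valid ⊢A⊃B v ⟩
    ⊤ₐ                     ∎
    where open ≡-Reasoning
  sound axioms-valid (sub {A} x B ⊢A) v =
    trans (eval-[≔] v x B A) (sound axioms-valid ⊢A (update v x (eval v B)))

  InPQR : Form → Set
  InPQR (var 0)  = ⊤
  InPQR (var 1)  = ⊤
  InPQR (var 2)  = ⊤
  InPQR (var _)  = ⊥
  InPQR bot      = ⊤
  InPQR (A ∧′ B) = InPQR A × InPQR B
  InPQR (A ∨′ B) = InPQR A × InPQR B
  InPQR (A ⇒ B)  = InPQR A × InPQR B
  InPQR (A ⊃ B)  = InPQR A × InPQR B

  pqr↦ : Carrier → Carrier → Carrier → Valuation
  pqr↦ x y z 0 = x
  pqr↦ x y z 1 = y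
  pqr↦ x y z _ = z

  eval-InPQR : ∀ A → InPQR A → ∀ v → eval v A ≡ eval (pqr↦ (v 0) (v 1) (v 2)) A
  eval-InPQR (var 0)                   _ v = refl
  eval-InPQR (var 1)                   _ v = refl
  eval-InPQR (var 2)                   _ v = refl
  eval-InPQR (var (suc (suc (suc _)))) () v
  eval-InPQR bot      _       v = refl
  eval-InPQR (A ∧′ B) (a , b) v = cong₂ _∧ₐ_ (eval-InPQR A a v) (eval-InPQR B b v)
  eval-InPQR (A ∨′ B) (a , b) v = cong₂ _∨ₐ_ (eval-InPQR A a v) (eval-InPQR B b v)
  eval-InPQR (A ⇒ B)  (a , b) v = cong₂ _→ₐ_ (eval-InPQR A a v) (eval-InPQR B b v)
  eval-InPQR (A ⊃ B)  (a , b) v = cong₂ _⊃ₐ_ (eval-InPQR A a v) (eval-InPQR B b v)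

  module TruthTables (search : Searchable Carrier) where

    valid-pqr? : (A : Form) → Dec (∀ x y z → eval (pqr↦ x y z) A ≡ ⊤ₐ)
    valid-pqr? A = search λ x → search λ y → search λ z → is⊤? (eval (pqr↦ x y z) A)

    valid-by-truth-table : (A : Form) {inPQR : InPQR A} {ok : True (valid-pqr? A)} → Valid A
    valid-by-truth-table A {inPQR} {ok} v =
      trans (eval-InPQR A inPQR v) (toWitness ok (v 0) (v 1) (v 2))

record DisjFreeEmbedding (M N : Model) : Set where
  private
    module M = Model M
    module N = Model N
  field
    ⟦_⟧        : M.Carrier → N.Carrier
    ⟦⊥⟧        : ⟦ M.⊥ₐ ⟧ ≡ N.⊥ₐ
    ⟦∧⟧        : ∀ x y → ⟦ x M.∧ₐ y ⟧ ≡ ⟦ x ⟧ N.∧ₐ ⟦ y ⟧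
    ⟦→⟧        : ∀ x y → ⟦ x M.→ₐ y ⟧ ≡ ⟦ x ⟧ N.→ₐ ⟦ y ⟧
    ⟦⊃⟧        : ∀ x y → ⟦ x M.⊃ₐ y ⟧ ≡ ⟦ x ⟧ N.⊃ₐ ⟦ y ⟧
    reflects-⊤ : ∀ x → ⟦ x ⟧ ≡ N.⊤ₐ → x ≡ M.⊤ₐ

module _ {M N : Model} (h : DisjFreeEmbedding M N) where
  open DisjFreeEmbedding h
  private
    module M = Semantics M
    module N = Semantics N

  eval-⟦⟧ : ∀ v A → DisjFree A → N.eval (λ x → ⟦ v x ⟧) A ≡ ⟦ M.eval v A ⟧
  eval-⟦⟧ v (var x)  _       = refl
  eval-⟦⟧ v bot      _       = sym ⟦⊥⟧
  eval-⟦⟧ v (A ∧′ B) (a , b) =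
    trans (cong₂ (Model._∧ₐ_ N) (eval-⟦⟧ v A a) (eval-⟦⟧ v B b)) (sym (⟦∧⟧ _ _))
  eval-⟦⟧ v (A ⇒ B)  (a , b) =
    trans (cong₂ (Model._→ₐ_ N) (eval-⟦⟧ v A a) (eval-⟦⟧ v B b)) (sym (⟦→⟧ _ _))
  eval-⟦⟧ v (A ⊃ B)  (a , b) =
    trans (cong₂ (Model._⊃ₐ_ N) (eval-⟦⟧ v A a) (eval-⟦⟧ v B b)) (sym (⟦⊃⟧ _ _))

  DisjFree-Valid-reflect : ∀ {A} → DisjFree A → N.Valid A → M.Valid A
  DisjFree-Valid-reflect {A} disjFree N⊨A v =
    reflects-⊤ _ (trans (sym (eval-⟦⟧ v A disjFree)) (N⊨A (λ x → ⟦ v x ⟧)))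

_⁺ : Model → Model
M ⁺ = record
  { Carrier = Maybe Carrier
  ; ⊥ₐ      = just ⊥ₐ
  ; ⊤ₐ      = nothing
  ; _∧ₐ_    = meet
  ; _∨ₐ_    = join
  ; _→ₐ_    = imp
  ; is⊤?    = λ { nothing → yes refl ; (just _) → no λ () }
  }
  where
  open Model M

  meet join imp : Maybe Carrier → Maybe Carrier → Maybe Carrier
  meet nothing  y        = y
  meet x        nothing  = x
  meet (just x) (just y) = just (x ∧ₐ y)

  join nothing  _        = nothing
  join _        nothing  = nothing
  join (just x) (just y) = just (x ∨ₐ y)

  imp nothing  y        = y
  imp (just _) nothing  = nothing
  imp (just x) (just y) = if does (is⊤? (x →ₐ y)) then nothing else just (x →ₐ y)

identify-tops : (M : Model) → Model.Carrier M → Model.Carrier (M ⁺)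
identify-tops M x = if does (Model.is⊤? M x) then nothing else just x

𝟚² : Model
𝟚² = record
  { Carrier = Bool × Bool
  ; ⊥ₐ      = false , false
  ; ⊤ₐ      = true , true
  ; _∧ₐ_    = zip′ Bool._∧_ Bool._∧_
  ; _∨ₐ_    = zip′ Bool._∨_ Bool._∨_
  ; _→ₐ_    = zip′ implies implies
  ; is⊤?    = λ x → Product.≡-dec Bool._≟_ Bool._≟_ x (true , true)
  }
  where
  implies : Bool → Bool → Bool
  implies x y = not x Bool.∨ y

𝟚²-searchable : Searchable (Bool × Bool)
𝟚²-searchable = ×-searchable Bool-searchable Bool-searchable

module _ where
  open Semantics.TruthTables 𝟚² 𝟚²-searchable

  𝟚²-BaseAxiom-valid : ∀ {A} → BaseAxiom A → Semantics.Valid 𝟚² A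
  𝟚²-BaseAxiom-valid {A} ax0  = valid-by-truth-table A
  𝟚²-BaseAxiom-valid {A} ax1  = valid-by-truth-table A
  𝟚²-BaseAxiom-valid {A} ax2  = valid-by-truth-table A
  𝟚²-BaseAxiom-valid {A} ax3  = valid-by-truth-table A
  𝟚²-BaseAxiom-valid {A} ax4  = valid-by-truth-table A
  𝟚²-BaseAxiom-valid {A} ax5  = valid-by-truth-table A
  𝟚²-BaseAxiom-valid {A} ax6  = valid-by-truth-table A
  𝟚²-BaseAxiom-valid {A} ax7  = valid-by-truth-table A
  𝟚²-BaseAxiom-valid {A} ax8  = valid-by-truth-table A
  𝟚²-BaseAxiom-valid {A} axM1 = valid-by-truth-table A
  𝟚²-BaseAxiom-valid {A} axM2 = valid-by-truth-table A
  𝟚²-BaseAxiom-valid {A} axM3 = valid-by-truth-table A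
  𝟚²-BaseAxiom-valid {A} axM4 = valid-by-truth-table A
  𝟚²-BaseAxiom-valid {A} axM5 = valid-by-truth-table A

𝟚²-AxM6′-invalid : ¬ Semantics.Valid 𝟚² AxM6′
𝟚²-AxM6′-invalid valid
  with valid (Semantics.pqr↦ 𝟚² (true , false) (false , true) (false , false))
... | ()

𝟚²⁺ : Model
𝟚²⁺ = 𝟚² ⁺

module _ where
  open Semantics.TruthTables 𝟚²⁺ (Maybe-searchable 𝟚²-searchable)

  𝟚²⁺-S2Axiom-valid : ∀ {A} → S2Axiom A → Semantics.Valid 𝟚²⁺ A
  𝟚²⁺-S2Axiom-valid {A} (base ax0)  = valid-by-truth-table A
  𝟚²⁺-S2Axiom-valid {A} (base ax1)  = valid-by-truth-table A
  𝟚²⁺-S2Axiom-valid {A} (base ax2)  = valid-by-truth-table A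
  𝟚²⁺-S2Axiom-valid {A} (base ax3)  = valid-by-truth-table A
  𝟚²⁺-S2Axiom-valid {A} (base ax4)  = valid-by-truth-table A
  𝟚²⁺-S2Axiom-valid {A} (base ax5)  = valid-by-truth-table A
  𝟚²⁺-S2Axiom-valid {A} (base ax6)  = valid-by-truth-table A
  𝟚²⁺-S2Axiom-valid {A} (base ax7)  = valid-by-truth-table A
  𝟚²⁺-S2Axiom-valid {A} (base ax8)  = valid-by-truth-table A
  𝟚²⁺-S2Axiom-valid {A} (base axM1) = valid-by-truth-table A
  𝟚²⁺-S2Axiom-valid {A} (base axM2) = valid-by-truth-table A
  𝟚²⁺-S2Axiom-valid {A} (base axM3) = valid-by-truth-table A
  𝟚²⁺-S2Axiom-valid {A} (base axM4) = valid-by-truth-table A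
  𝟚²⁺-S2Axiom-valid {A} (base axM5) = valid-by-truth-table A
  𝟚²⁺-S2Axiom-valid {A} axM6        = valid-by-truth-table A

𝟚²↪𝟚²⁺ : DisjFreeEmbedding 𝟚² 𝟚²⁺
𝟚²↪𝟚²⁺ = record
  { ⟦_⟧        = ι
  ; ⟦⊥⟧        = refl
  ; ⟦∧⟧        = from-yes (∀²? λ x y → ι (x B.∧ₐ y) ≟⁺ ι x B⁺.∧ₐ ι y)
  ; ⟦→⟧        = from-yes (∀²? λ x y → ι (x B.→ₐ y) ≟⁺ ι x B⁺.→ₐ ι y)
  ; ⟦⊃⟧        = from-yes (∀²? λ x y → ι (x B.⊃ₐ y) ≟⁺ ι x B⁺.⊃ₐ ι y)
  ; reflects-⊤ = from-yes (𝟚²-searchable λ x → ι x ≟⁺ nothing →-dec x ≟² (true , true))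
  }
  where
  module B  = Model 𝟚²
  module B⁺ = Model 𝟚²⁺
  infix 4 _≟²_ _≟⁺_

  ι : Bool × Bool → Maybe (Bool × Bool)
  ι = identify-tops 𝟚²

  _≟²_ : (x y : Bool × Bool) → Dec (x ≡ y)
  _≟²_ = Product.≡-dec Bool._≟_ Bool._≟_

  _≟⁺_ : (x y : Maybe (Bool × Bool)) → Dec (x ≡ y)
  _≟⁺_ = Maybe.≡-dec _≟²_

  ∀²? : {P : Bool × Bool → Bool × Bool → Set} →
        (∀ x y → Dec (P x y)) → Dec (∀ x y → P x y)
  ∀²? P? = 𝟚²-searchable λ x → 𝟚²-searchable λ y → P? x y

mainTheorem16 : ¬ (Σ Form (λ A → DisjFree A × (S2⊢ A) × (A ⊢⁻+ AxM6′)))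
mainTheorem16 (A , disjFree , S2⊢A , A⊢AxM6′) =
  𝟚²-AxM6′-invalid (Semantics.sound 𝟚² axioms-valid A⊢AxM6′)
  where
  𝟚²⊨A : Semantics.Valid 𝟚² A
  𝟚²⊨A = DisjFree-Valid-reflect 𝟚²↪𝟚²⁺ disjFree
           (Semantics.sound 𝟚²⁺ 𝟚²⁺-S2Axiom-valid S2⊢A)

  axioms-valid : ∀ {B} → MinusPlus A B → Semantics.Valid 𝟚² B
  axioms-valid (base ax) = 𝟚²-BaseAxiom-valid ax
  axioms-valid extra     = 𝟚²⊨A
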